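{- Let $D=(V,E)$ be a finite digraph (parallel edges allowed, no loops) and let $r\in V$, where no edge of $D$ has head $r$. Then \[ \mathcal{F}_{D,r}:=\{ E(F) \mid F\subseteq D \text{ is an } r\text{ -flame} \} \] is a greedoid on $E$. Furthermore, for each $\subseteq$-maximal element $E(F^{*})$ of $\mathcal{F}_{D,r}$ we have $\lambda_{F^{*}}(r,v)=\lambda_D(r,v)$ for all $v\in V-r$.
   Context: Subdigraphs $F\subseteq D$ are taken on the vertex set $V$ with $E(F)\subseteq E$. For a digraph $H$ on $V$ and $v\in V-r$, $\lambda_H(r,v)$ denotes the local edge-connectivity from $r$ to $v$ in $H$, i.e. the maximal number of pairwise edge-disjoint directed $r\to v$ paths in $H$, and $\varrho_H(v)$ denotes the in-degree of $v$ in $H$. A digraph $F$ on $V$ is an $r$-flame if $\varrho_F(v)=\lambda_F(r,v)$ for every $v\in V-r$. A family $\mathcal{F}\subseteq 2^E$ is a greedoid on $E$ if $\varnothing\in\mathcal{F}$ and whenever $F,F'\in\mathcal{F}$ with $|F|<|F'|$ there is $e\in F'\setminus F$ with $F\cup\{e\}\in\mathcal{F}$. -}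

module Defs where

open import Data.Nat using (ℕ; suc; _<_)
open import Data.Fin using (Fin; _≟_)
open import Data.Fin.Subset using (Subset; _∈_; _∉_; _⊆_; ∣_∣; ⊥; _∪_; ⁅_⁆)
open import Data.Fin.Subset.Properties using (_∈?_)
open import Data.List using (List; []; _∷_; map; filter; length; allFin)
import Data.List.Membership.Propositional as LM
open import Data.List.Relation.Unary.Unique.Propositional using (Unique)
open import Data.Product using (Σ; ∃; _×_)
open import Relation.Binary.PropositionalEquality using (_≡_; _≢_)
open import Relation.Nullary using (¬_)
open import Relation.Nullary.Decidable using (_×-dec_)

record Digraph : Set where
  field
    n  : ℕ
    m  : ℕ
    tl : Fin m → Fin n
    hd : Fin m → Fin n

module _ (D : Digraph) where
  open Digraph D

  -- A spanning subdigraph F ⊆ D is given by its edge set E(F) : Subset m.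

  data IsWalk (H : Subset m) : Fin n → Fin n → List (Fin m) → Set where
    []  : ∀ {x} → IsWalk H x x []
    _∷_ : ∀ {x y e es} → (tl e ≡ x) × (e ∈ H) → IsWalk H (hd e) y es →
          IsWalk H x y (e ∷ es)

  IsPath : Subset m → Fin n → Fin n → List (Fin m) → Set
  IsPath H x y es = IsWalk H x y es × Unique (x ∷ map hd es)

  HasDisjointPaths : Subset m → Fin n → Fin n → ℕ → Set
  HasDisjointPaths H x y k =
    Σ (Fin k → List (Fin m)) λ P →
      (∀ i → IsPath H x y (P i)) ×
      (∀ i j → i ≢ j → ∀ e → e LM.∈ P i → e LM.∈ P j → Data.Empty.⊥)
    where import Data.Empty

  IsLambda : Subset m → Fin n → Fin n → ℕ → Set
  IsLambda H x y k = HasDisjointPaths H x y k × ¬ HasDisjointPaths H x y (suc k)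

  indeg : Subset m → Fin n → ℕ
  indeg H v = length (filter (λ e → (e ∈? H) ×-dec (hd e ≟ v)) (allFin m))

  IsFlame : Fin n → Subset m → Set
  IsFlame r F = ∀ v → v ≢ r → IsLambda F r v (indeg F v)

IsGreedoid : ∀ {m} → (Subset m → Set) → Set
IsGreedoid {m} 𝓕 =
  𝓕 ⊥ ×
  (∀ F F' → 𝓕 F → 𝓕 F' → ∣ F ∣ < ∣ F' ∣ →
     ∃ λ e → e ∈ F' × e ∉ F × 𝓕 (F ∪ ⁅ e ⁆))

module Submission where

-- The proof goes through Menger's theorem, proved here from scratch by augmenting paths.
-- Edge sets are weighted by 0/1 indicators and all counting is done with finite sums.
--
--  * Walks and reachability: a walk is a unit flow (conservation at inner vertices),
--    walks shortcut to paths, and the vertices reachable from s form a closed set.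
--  * Flows: a flow of value k sends exactly k units across every s-t cut; a 0/1 flow
--    decomposes into k edge-disjoint paths; an augmenting path in the residual graph
--    raises the value, and if t is unreachable the unreachable vertices form a cut of
--    size k. Hence Menger: k disjoint paths and a cut of size k, so λ_H(s,t) = k.
--  * Flames: F is an r-flame iff every vertex set Y ∋ v, Y ∌ r is entered by at least
--    ϱ_F(v) edges of F (cut condition). Sets attaining equality (tight sets) are closed
--    under union by submodularity. An edge e ∉ F can be added to a flame unless some set
--    tight for its head contains its tail; growing tight sets around v then shows that if
--    no edge of C can be added, some tight set T for v has ϱ_C(T) ≤ ϱ_F(T).
--  * The theorem: applying this with C = F' (a larger flame) gives the greedoid exchange
--    axiom, and with C = E(D) (for a maximal flame) gives λ_F*(r,v) = λ_D(r,v).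

open import Defs
open import Data.Nat using (ℕ; zero; suc; _+_; _*_; _≤_; _<_; z≤n; s≤s; _≤?_; _<?_)
open import Data.Nat.Properties
open import Data.Nat.Tactic.RingSolver using (solve-∀)
open import Data.Fin using (Fin; zero; suc; _↑ˡ_; _↑ʳ_; splitAt; punchIn; punchOut)
import Data.Fin as Fin
open import Data.Fin.Properties
  using (any?; punchInᵢ≢i; punchIn-injective; punchOut-injective; punchIn-punchOut;
         splitAt-↑ˡ; splitAt-↑ʳ; inject≤-injective)
open import Data.Fin.Subset using (Subset; _∈_; _∉_; _⊆_; _∪_; _∩_; ⁅_⁆; ∣_∣; ∁; ⊤) renaming (⊥ to ∅)
open import Data.Fin.Subset.Properties using (_∈?_; ⊆-min; ∈⊤; p⊆p∪q; q⊆p∪q; x∈⁅x⁆)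
open import Data.Bool using (Bool; true; false; _∧_; _∨_; not)
open import Data.Bool.Properties
  using (∧-conicalˡ; ∧-conicalʳ; not-involutive; ∧-identityʳ; ∧-zeroʳ; ∨-identityʳ; ∨-zeroʳ)
  renaming (_≟_ to _≟ᵇ_)
open import Data.Vec using (lookup; tabulate) renaming (_∷_ to _∷ᵛ_; [] to []ᵛ)
open import Data.Vec.Properties
  using ([]=⇒lookup; lookup⇒[]=; lookup∘tabulate; lookup-map; lookup-replicate; lookup-zipWith)
open import Data.List using (List; []; _∷_; map; _++_; filter; length)
import Data.List as List
open import Data.List.Relation.Unary.Any using (here; there)
open import Data.List.Relation.Unary.All using ([]; _∷_)
open import Data.List.Relation.Unary.All.Properties using (¬Any⇒All¬; All¬⇒¬Any)
open import Data.List.Relation.Unary.AllPairs using ([]; _∷_)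
open import Data.List.Membership.Propositional using () renaming (_∈_ to _∈ₗ_)
import Data.List.Membership.DecPropositional as DecMembership
open import Data.List.Membership.Propositional.Properties using (∈-map⁺)
open import Relation.Nullary using (¬_; Dec; yes; no; does)
open import Relation.Nullary.Decidable using (_×-dec_)
open import Relation.Unary using (Decidable)
open import Relation.Binary.PropositionalEquality
open import Data.Empty using (⊥; ⊥-elim)
open import Data.Product using (Σ; ∃; _×_; _,_; proj₁; proj₂)
open import Data.Sum using (_⊎_; inj₁; inj₂; [_,_]′)
open import Function using (_∘_; id; _⇔_; mk⇔; Equivalence)
open import Algebra.Properties.Semiring.Sum +-*-semiring
  using (sum; sum-cong-≗; ∑-distrib-+; ∑-comm; *-distribˡ-sum; sum-replicate-zero)

⟦_⟧ : Bool → ℕ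
⟦ true ⟧ = 1
⟦ false ⟧ = 0

⟦⟧≤1 : ∀ b → ⟦ b ⟧ ≤ 1
⟦⟧≤1 true = s≤s z≤n
⟦⟧≤1 false = z≤n

⟦∧⟧ : ∀ a b → ⟦ a ∧ b ⟧ ≡ ⟦ a ⟧ * ⟦ b ⟧
⟦∧⟧ true true = refl
⟦∧⟧ true false = refl
⟦∧⟧ false b = refl

⟦∧⟧≤ˡ : ∀ a b → ⟦ a ∧ b ⟧ ≤ ⟦ a ⟧
⟦∧⟧≤ˡ true b = ⟦⟧≤1 b
⟦∧⟧≤ˡ false b = z≤n

⟦∧⟧≤ʳ : ∀ a b → ⟦ a ∧ b ⟧ ≤ ⟦ b ⟧
⟦∧⟧≤ʳ true b = ≤-refl
⟦∧⟧≤ʳ false b = z≤n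

⟦∨⟧+⟦∧⟧ : ∀ a b → ⟦ a ∨ b ⟧ + ⟦ a ∧ b ⟧ ≡ ⟦ a ⟧ + ⟦ b ⟧
⟦∨⟧+⟦∧⟧ true true = refl
⟦∨⟧+⟦∧⟧ true false = refl
⟦∨⟧+⟦∧⟧ false b = +-identityʳ ⟦ b ⟧

_≡ᵇ_ : ∀ {k} → Fin k → Fin k → Bool
i ≡ᵇ j = does (i Fin.≟ j)

≡ᵇ-refl : ∀ {k} (i : Fin k) → (i ≡ᵇ i) ≡ true
≡ᵇ-refl i with i Fin.≟ i
... | yes _ = refl
... | no i≢i = ⊥-elim (i≢i refl)

≡ᵇ-≢ : ∀ {k} {i j : Fin k} → i ≢ j → (i ≡ᵇ j) ≡ false
≡ᵇ-≢ {i = i} {j} i≢j with i Fin.≟ j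
... | yes i≡j = ⊥-elim (i≢j i≡j)
... | no _ = refl

≡ᵇ-sym : ∀ {k} (i j : Fin k) → (i ≡ᵇ j) ≡ (j ≡ᵇ i)
≡ᵇ-sym i j with i Fin.≟ j
... | yes refl = sym (≡ᵇ-refl i)
... | no i≢j = sym (≡ᵇ-≢ (i≢j ∘ sym))

≡ᵇ-true : ∀ {k} {i j : Fin k} → (i ≡ᵇ j) ≡ true → i ≡ j
≡ᵇ-true {i = i} {j} e with i Fin.≟ j
... | yes i≡j = i≡j

true≢false : true ≢ false
true≢false ()

∧-true : ∀ {a b} → (a ∧ b) ≡ true → a ≡ true × b ≡ true
∧-true {a} {b} e = ∧-conicalˡ a b e , ∧-conicalʳ a b e

not-true : ∀ {a} → not a ≡ true → a ≡ false
not-true {a} e = trans (sym (not-involutive a)) (cong not e)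

sum-mono : ∀ {k} {f g : Fin k → ℕ} → (∀ i → f i ≤ g i) → sum f ≤ sum g
sum-mono {zero} f≤g = z≤n
sum-mono {suc k} f≤g = +-mono-≤ (f≤g zero) (sum-mono (f≤g ∘ suc))

sum-strict : ∀ {k} {f g : Fin k → ℕ} → (∀ i → f i ≤ g i) → (j : Fin k) → f j < g j → sum f < sum g
sum-strict {suc k} f≤g zero lt = +-mono-<-≤ lt (sum-mono (f≤g ∘ suc))
sum-strict {suc k} f≤g (suc j) lt = +-mono-≤-< (f≤g zero) (sum-strict (f≤g ∘ suc) j lt)

sum-zero : ∀ {k} (f : Fin k → ℕ) → (∀ i → f i ≡ 0) → sum f ≡ 0
sum-zero {k} f f≡0 = trans (sum-cong-≗ f≡0) (sum-replicate-zero k)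

sum-one : ∀ k → sum {k} (λ _ → 1) ≡ k
sum-one zero = refl
sum-one (suc k) = cong suc (sum-one k)

sum-point : ∀ {k} (e : Fin k) (g : Fin k → ℕ) → sum (λ i → ⟦ i ≡ᵇ e ⟧ * g i) ≡ g e
sum-point {suc k} zero g =
  trans (cong₂ _+_ (+-identityʳ (g zero))
                   (sum-zero _ (λ i → cong (λ b → ⟦ b ⟧ * g (suc i)) (≡ᵇ-≢ {i = suc i} {j = zero} λ ()))))
        (+-identityʳ (g zero))
sum-point {suc k} (suc e) g =
  cong₂ _+_ (cong (λ b → ⟦ b ⟧ * g zero) (≡ᵇ-≢ {i = zero} {j = suc e} λ ()))
            (trans (sum-cong-≗ (λ i → cong (λ b → ⟦ b ⟧ * g (suc i)) (shift i))) (sum-point e (g ∘ suc)))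
  where
  shift : ∀ i → (suc i ≡ᵇ suc e) ≡ (i ≡ᵇ e)
  shift i with i Fin.≟ e
  ... | yes _ = refl
  ... | no _ = refl

sum-split : ∀ a b (f : Fin (a + b) → ℕ) → sum f ≡ sum (λ i → f (i ↑ˡ b)) + sum (λ j → f (a ↑ʳ j))
sum-split zero b f = refl
sum-split (suc a) b f = trans (cong (f zero +_) (sum-split a b (f ∘ suc))) (sym (+-assoc (f zero) _ _))

-- Counting by injection: k distinct points satisfying P show that at least k points satisfy P.
-- Induction on the ground set: remove the point zero (and its preimage, if any).
count-injection : ∀ {k m} (P : Fin m → Bool) (g : Fin k → Fin m) →
  (∀ i j → g i ≡ g j → i ≡ j) → (∀ i → P (g i) ≡ true) → k ≤ sum (λ x → ⟦ P x ⟧)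

count-injection-descend : ∀ {k m} (P : Fin (suc m) → Bool) (g : Fin k → Fin (suc m)) →
  (∀ i j → g i ≡ g j → i ≡ j) → (∀ i → P (g i) ≡ true) → (∀ i → zero ≢ g i) → k ≤ sum (λ x → ⟦ P (suc x) ⟧)

count-injection {zero} P g inj Pg = z≤n
count-injection {suc k} {zero} P g inj Pg with g zero
... | ()
count-injection {suc k} {suc m} P g inj Pg with any? (λ i → g i Fin.≟ zero)
... | yes (i₀ , gi₀≡0) =
  subst (λ b → suc k ≤ ⟦ b ⟧ + sum (λ x → ⟦ P (suc x) ⟧)) (sym (trans (cong P (sym gi₀≡0)) (Pg i₀)))
        (s≤s (count-injection-descend P (g ∘ punchIn i₀) (λ i j → punchIn-injective i₀ i j ∘ inj _ _) (Pg ∘ punchIn i₀)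
                                      (λ j 0≡g → punchInᵢ≢i i₀ j (inj _ _ (trans (sym 0≡g) (sym gi₀≡0))))))
... | no ¬hit = ≤-trans (count-injection-descend P g inj Pg (λ j 0≡g → ¬hit (j , sym 0≡g))) (m≤n+m _ _)

count-injection-descend P g inj Pg avoids =
  count-injection (P ∘ suc) (λ i → punchOut (avoids i))
                  (λ i j e → inj i j (punchOut-injective (avoids i) (avoids j) e))
                  (λ i → trans (cong P (punchIn-punchOut (avoids i))) (Pg i))

mem : ∀ {k} → Subset k → Fin k → Bool
mem A x = lookup A x

∈⇒mem : ∀ {k} {A : Subset k} {x} → x ∈ A → mem A x ≡ true
∈⇒mem = []=⇒lookup

mem⇒∈ : ∀ {k} {A : Subset k} {x} → mem A x ≡ true → x ∈ A
mem⇒∈ {A = A} {x} = lookup⇒[]= x A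

mem-∪ : ∀ {k} (A B : Subset k) x → mem (A ∪ B) x ≡ (mem A x ∨ mem B x)
mem-∪ A B x = lookup-zipWith _∨_ x A B

mem-∩ : ∀ {k} (A B : Subset k) x → mem (A ∩ B) x ≡ (mem A x ∧ mem B x)
mem-∩ A B x = lookup-zipWith _∧_ x A B

mem-⁅⁆ : ∀ {k} (e x : Fin k) → mem ⁅ e ⁆ x ≡ (x ≡ᵇ e)
mem-⁅⁆ zero zero = refl
mem-⁅⁆ zero (suc x) = lookup-replicate x false
mem-⁅⁆ (suc e) zero = refl
mem-⁅⁆ (suc e) (suc x) = trans (mem-⁅⁆ e x) (shift x e)
  where
  shift : ∀ {k} (x e : Fin k) → (x ≡ᵇ e) ≡ (suc x ≡ᵇ suc e)
  shift x e with x Fin.≟ e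
  ... | yes _ = refl
  ... | no _ = refl

mem-∪⁅⁆ : ∀ {k} (A : Subset k) x w → mem (A ∪ ⁅ x ⁆) w ≡ (mem A w ∨ (w ≡ᵇ x))
mem-∪⁅⁆ A x w = trans (mem-∪ A ⁅ x ⁆ w) (cong (mem A w ∨_) (mem-⁅⁆ x w))

card-sum : ∀ {k} (p : Subset k) → ∣ p ∣ ≡ sum (λ x → ⟦ mem p x ⟧)
card-sum []ᵛ = refl
card-sum (true ∷ᵛ p) = cong suc (card-sum p)
card-sum (false ∷ᵛ p) = card-sum p

length-filter-sum : ∀ {A : Set} {P : A → Set} (P? : Decidable P) {k} (f : Fin k → A) →
  length (filter P? (List.tabulate f)) ≡ sum (λ i → ⟦ does (P? (f i)) ⟧)
length-filter-sum P? {zero} f = refl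
length-filter-sum P? {suc k} f with does (P? (f zero))
... | true = cong suc (length-filter-sum P? (f ∘ suc))
... | false = length-filter-sum P? (f ∘ suc)

does-∈? : ∀ {k} (x : Fin k) (p : Subset k) → does (x ∈? p) ≡ mem p x
does-∈? zero (true ∷ᵛ p) = refl
does-∈? zero (false ∷ᵛ p) = refl
does-∈? (suc x) (b ∷ᵛ p) = does-∈? x p

count : ∀ {k} → List (Fin k) → Fin k → ℕ
count [] z = 0
count (e ∷ L) z = ⟦ z ≡ᵇ e ⟧ + count L z

sum-count-∷ : ∀ {k} (e : Fin k) (L : List (Fin k)) (h : Fin k → ℕ) →
  sum (λ z → count (e ∷ L) z * h z) ≡ h e + sum (λ z → count L z * h z)
sum-count-∷ e L h = begin
  sum (λ z → count (e ∷ L) z * h z)                             ≡⟨ sum-cong-≗ (λ z → *-distribʳ-+ (h z) ⟦ z ≡ᵇ e ⟧ (count L z)) ⟩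
  sum (λ z → ⟦ z ≡ᵇ e ⟧ * h z + count L z * h z)                ≡⟨ ∑-distrib-+ (λ z → ⟦ z ≡ᵇ e ⟧ * h z) _ ⟩
  sum (λ z → ⟦ z ≡ᵇ e ⟧ * h z) + sum (λ z → count L z * h z)    ≡⟨ cong (_+ _) (sum-point e h) ⟩
  h e + sum (λ z → count L z * h z)                              ∎
  where open ≡-Reasoning

count≢0⇒∈ : ∀ {k} {L : List (Fin k)} {z} → count L z ≢ 0 → z ∈ₗ L
count≢0⇒∈ {L = []} c≢0 = ⊥-elim (c≢0 refl)
count≢0⇒∈ {L = e ∷ L} {z} c≢0 with z Fin.≟ e
... | yes z≡e = here z≡e
... | no _ = there (count≢0⇒∈ c≢0)

∈⇒count≢0 : ∀ {k} {L : List (Fin k)} {z} → z ∈ₗ L → count L z ≢ 0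
∈⇒count≢0 {L = e ∷ L} (here refl) rewrite ≡ᵇ-refl e = λ ()
∈⇒count≢0 {L = e ∷ L} {z} (there z∈L) c≡0 = ∈⇒count≢0 z∈L (m+n≡0⇒n≡0 ⟦ z ≡ᵇ e ⟧ c≡0)

module Walks (G : Digraph) where
  open Digraph G

  walk-⊆ : ∀ {A x y L e} → IsWalk G A x y L → e ∈ₗ L → e ∈ A
  walk-⊆ ((_ , e∈A) ∷ w) (here refl) = e∈A
  walk-⊆ (_ ∷ w) (there e∈L) = walk-⊆ w e∈L

  walk-mono : ∀ {A B x y L} → A ⊆ B → IsWalk G A x y L → IsWalk G B x y L
  walk-mono A⊆B [] = []
  walk-mono A⊆B ((t , e∈A) ∷ w) = (t , A⊆B e∈A) ∷ walk-mono A⊆B w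

  walk-conservation : ∀ {A x y L} → IsWalk G A x y L → ∀ w →
    sum (λ e → count L e * ⟦ tl e ≡ᵇ w ⟧) + ⟦ w ≡ᵇ y ⟧ ≡ sum (λ e → count L e * ⟦ hd e ≡ᵇ w ⟧) + ⟦ w ≡ᵇ x ⟧
  walk-conservation [] w = refl
  walk-conservation {x = x} {y} {e ∷ L} ((refl , _) ∷ rest) w = begin
    sum (λ z → count (e ∷ L) z * ⟦ tl z ≡ᵇ w ⟧) + ⟦ w ≡ᵇ y ⟧  ≡⟨ cong (_+ ⟦ w ≡ᵇ y ⟧) (sum-count-∷ e L (λ z → ⟦ tl z ≡ᵇ w ⟧)) ⟩
    (out-e + out) + ⟦ w ≡ᵇ y ⟧                                ≡⟨ +-assoc out-e out _ ⟩
    out-e + (out + ⟦ w ≡ᵇ y ⟧)                                ≡⟨ cong (out-e +_) (walk-conservation rest w) ⟩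
    out-e + (inn + ⟦ w ≡ᵇ hd e ⟧)                             ≡⟨ +-comm out-e _ ⟩
    (inn + ⟦ w ≡ᵇ hd e ⟧) + out-e                             ≡⟨ cong₂ _+_ (trans (+-comm inn _) (cong (λ b → ⟦ b ⟧ + inn) (≡ᵇ-sym w (hd e)))) (cong ⟦_⟧ (≡ᵇ-sym (tl e) w)) ⟩
    (⟦ hd e ≡ᵇ w ⟧ + inn) + ⟦ w ≡ᵇ tl e ⟧                     ≡⟨ cong (_+ ⟦ w ≡ᵇ tl e ⟧) (sym (sum-count-∷ e L (λ z → ⟦ hd z ≡ᵇ w ⟧))) ⟩
    sum (λ z → count (e ∷ L) z * ⟦ hd z ≡ᵇ w ⟧) + ⟦ w ≡ᵇ tl e ⟧  ∎
    where
    open ≡-Reasoning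
    out-e = ⟦ tl e ≡ᵇ w ⟧
    out = sum (λ z → count L z * ⟦ tl z ≡ᵇ w ⟧)
    inn = sum (λ z → count L z * ⟦ hd z ≡ᵇ w ⟧)

  -- On a path every edge occurs at most once (its head would otherwise repeat).
  path-count≤1 : ∀ {A x y L} → IsPath G A x y L → ∀ z → count L z ≤ 1
  path-count≤1 ([] , _) z = z≤n
  path-count≤1 {L = e ∷ L} (_ ∷ rest , _ ∷ unique-rest@(hd-new ∷ _)) z with z Fin.≟ e
  ... | no _ = path-count≤1 (rest , unique-rest) z
  ... | yes refl with count L z in c
  ...   | zero = s≤s z≤n
  ...   | suc _ = ⊥-elim (All¬⇒¬Any hd-new (∈-map⁺ hd (count≢0⇒∈ {L = L} (λ c≡0 → 0≢1+n (trans (sym c≡0) c)))))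

  path-suffix : ∀ {A x y L v} → IsPath G A x y L → v ∈ₗ (x ∷ map hd L) → Σ (List (Fin m)) λ L' → IsPath G A v y L'
  path-suffix {L = L} p (here refl) = L , p
  path-suffix {L = e ∷ L} (_ ∷ w , _ ∷ u) (there v∈) = path-suffix (w , u) v∈

  walk⇒path : ∀ {A x y L} → IsWalk G A x y L → Σ (List (Fin m)) λ L' → IsPath G A x y L'
  walk⇒path [] = [] , [] , [] ∷ []
  walk⇒path {x = x} {L = e ∷ L} (step ∷ rest) with walk⇒path rest
  ... | L' , w' , u' with DecMembership._∈?_ Fin._≟_ x (hd e ∷ map hd L')
  ... | yes revisit = path-suffix (w' , u') revisit
  ... | no fresh = e ∷ L' , (step ∷ w') , (¬Any⇒All¬ _ fresh ∷ u')

-- number of points outside a subset: the termination measure for growing a set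
missing : ∀ {k} → Subset k → ℕ
missing R = sum (λ w → ⟦ not (mem R w) ⟧)

missing-∪ : ∀ {k} (R Y : Subset k) x → mem R x ≡ false → mem Y x ≡ true → missing (R ∪ Y) < missing R
missing-∪ R Y x x∉R x∈Y = sum-strict pointwise x (begin-strict
  ⟦ not (mem (R ∪ Y) x) ⟧    ≡⟨ cong (λ b → ⟦ not b ⟧) (trans (mem-∪ R Y x) (trans (cong (mem R x ∨_) x∈Y) (∨-zeroʳ _))) ⟩
  0                          <⟨ s≤s z≤n ⟩
  1                          ≡⟨ cong (λ b → ⟦ not b ⟧) x∉R ⟨
  ⟦ not (mem R x) ⟧          ∎)
  where
  open ≤-Reasoning
  pointwise : ∀ w → ⟦ not (mem (R ∪ Y) w) ⟧ ≤ ⟦ not (mem R w) ⟧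
  pointwise w rewrite mem-∪ R Y w with mem R w
  ... | true = z≤n
  ... | false = ⟦⟧≤1 _

module Reach (G : Digraph) where
  open Digraph G

  walk-snoc : ∀ {A x y L e} → IsWalk G A x y L → tl e ≡ y → e ∈ A → IsWalk G A x (hd e) (L ++ (e ∷ []))
  walk-snoc [] t e∈A = (t , e∈A) ∷ []
  walk-snoc (step ∷ w) t e∈A = step ∷ walk-snoc w t e∈A

  Closed : Subset m → Subset n → Set
  Closed A R = ∀ x → mem A x ≡ true → mem R (tl x) ≡ true → mem R (hd x) ≡ true

  Reached : Subset m → Fin n → Subset n → Set
  Reached A s R = mem R s ≡ true × (∀ w → mem R w ≡ true → Σ (List (Fin m)) λ L → IsWalk G A s w L)

  reachable : ∀ A s → Σ (Subset n) λ R → Reached A s R × Closed A R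
  reachable A s = grow (suc (missing R₀)) R₀ ≤-refl (s∈R₀ , walks₀)
    where
    R₀ : Subset n
    R₀ = ⁅ s ⁆
    s∈R₀ : mem R₀ s ≡ true
    s∈R₀ = trans (mem-⁅⁆ s s) (≡ᵇ-refl s)
    walks₀ : ∀ w → mem R₀ w ≡ true → Σ (List (Fin m)) λ L → IsWalk G A s w L
    walks₀ w w∈R₀ with ≡ᵇ-true {i = w} (trans (sym (mem-⁅⁆ s w)) w∈R₀)
    ... | refl = [] , []
    leaving : Subset n → Fin m → Bool
    leaving R x = mem A x ∧ mem R (tl x) ∧ not (mem R (hd x))
    grow : ∀ fuel R → missing R < fuel → Reached A s R → Σ (Subset n) λ R → Reached A s R × Closed A R
    grow (suc fuel) R lt reached with any? (λ x → leaving R x ≟ᵇ true)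
    ... | no none = R , reached , closed
      where
      closed : Closed A R
      closed x x∈A tl∈R with mem R (hd x) in hd∈R
      ... | true = refl
      ... | false = ⊥-elim (none (x , trans (cong₂ (λ a b → a ∧ b ∧ not (mem R (hd x))) x∈A tl∈R) (cong not hd∈R)))
    ... | yes (x , x-leaves) = grow fuel R' (≤-trans (missing-∪ R ⁅ hd x ⁆ (hd x) hd∉R (trans (mem-⁅⁆ (hd x) (hd x)) (≡ᵇ-refl (hd x)))) (≤-pred lt)) (s∈R' , walks')
      where
      x∈A : mem A x ≡ true
      x∈A = proj₁ (∧-true x-leaves)
      rest : (mem R (tl x) ∧ not (mem R (hd x))) ≡ true
      rest = proj₂ (∧-true {mem A x} x-leaves)
      tl∈R : mem R (tl x) ≡ true
      tl∈R = proj₁ (∧-true rest)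
      hd∉R : mem R (hd x) ≡ false
      hd∉R = not-true (proj₂ (∧-true {mem R (tl x)} rest))
      R' = R ∪ ⁅ hd x ⁆
      s∈R' : mem R' s ≡ true
      s∈R' = trans (mem-∪⁅⁆ R (hd x) s) (cong (_∨ (s ≡ᵇ hd x)) (proj₁ reached))
      walks' : ∀ w → mem R' w ≡ true → Σ (List (Fin m)) λ L → IsWalk G A s w L
      walks' w w∈R' with mem R w in w∈R
      ... | true = proj₂ reached w w∈R
      ... | false with w Fin.≟ hd x
      ...   | yes refl = let (L , walk) = proj₂ reached (tl x) tl∈R in L ++ (x ∷ []) , walk-snoc walk refl (mem⇒∈ x∈A)
      ...   | no w≢hd = ⊥-elim (true≢false (trans (sym w∈R') (trans (mem-∪⁅⁆ R (hd x) w) (cong₂ _∨_ w∈R (≡ᵇ-≢ w≢hd)))))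

⟦⟧-split : ∀ a b → ⟦ a ⟧ ≡ ⟦ a ∧ b ⟧ + ⟦ a ∧ not b ⟧
⟦⟧-split true true = refl
⟦⟧-split true false = refl
⟦⟧-split false b = refl

-- Vertex balance transferred along an augmentation: if f' + b = f + a on edges
-- and a - b carries one unit from s to t, then the values of f and f' differ by one.
transfer : ∀ {O O' I I' Ao Bo Ai Bi T S K K'} →
  O' + Bo ≡ O + Ao → I' + Bi ≡ I + Ai → Ao + Bi + T ≡ Ai + Bo + S →
  (O + K ≡ I + K') ⇔ (O' + (T + K) ≡ I' + (S + K'))
transfer {O} {O'} {I} {I'} {Ao} {Bo} {Ai} {Bi} {T} {S} {K} {K'} out≡ in≡ unit =
  mk⇔ (λ e → +-cancelʳ-≡ C _ _ (trans lhs (trans (cong (_+ X) e) (sym rhs))))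
      (λ e → +-cancelʳ-≡ X _ _ (trans (sym lhs) (trans (cong (_+ C) e) rhs)))
  where
  open ≡-Reasoning
  C = Bo + Bi + Ai
  X = (Ai + Bo + S) + Ai
  regroup₁ : ∀ o' t k bo bi ai → o' + (t + k) + (bo + bi + ai) ≡ (o' + bo) + (t + k + bi + ai)
  regroup₁ = solve-∀
  regroup₂ : ∀ o ao t k bi ai → (o + ao) + (t + k + bi + ai) ≡ (o + k) + ((ao + bi + t) + ai)
  regroup₂ = solve-∀
  regroup₃ : ∀ i' s k' bo bi ai → i' + (s + k') + (bo + bi + ai) ≡ (i' + bi) + (s + k' + bo + ai)
  regroup₃ = solve-∀
  regroup₄ : ∀ i ai s k' bo → (i + ai) + (s + k' + bo + ai) ≡ (i + k') + ((ai + bo + s) + ai)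
  regroup₄ = solve-∀
  lhs : O' + (T + K) + C ≡ (O + K) + X
  lhs = begin
    O' + (T + K) + C                   ≡⟨ regroup₁ O' T K Bo Bi Ai ⟩
    (O' + Bo) + (T + K + Bi + Ai)      ≡⟨ cong (_+ (T + K + Bi + Ai)) out≡ ⟩
    (O + Ao) + (T + K + Bi + Ai)       ≡⟨ regroup₂ O Ao T K Bi Ai ⟩
    (O + K) + ((Ao + Bi + T) + Ai)     ≡⟨ cong (λ z → (O + K) + (z + Ai)) unit ⟩
    (O + K) + X                        ∎
  rhs : I' + (S + K') + C ≡ (I + K') + X
  rhs = begin
    I' + (S + K') + C                  ≡⟨ regroup₃ I' S K' Bo Bi Ai ⟩
    (I' + Bi) + (S + K' + Bo + Ai)     ≡⟨ cong (_+ (S + K' + Bo + Ai)) in≡ ⟩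
    (I + Ai) + (S + K' + Bo + Ai)      ≡⟨ regroup₄ I Ai S K' Bo ⟩
    (I + K') + X                       ∎

module Flows (G : Digraph) where
  open Digraph G

  Weight : Set
  Weight = Fin m → ℕ

  ind : Subset m → Weight
  ind P e = ⟦ mem P e ⟧

  weight : Weight → (Fin m → Bool) → ℕ
  weight f p = sum (λ e → f e * ⟦ p e ⟧)

  out inn : Weight → Fin n → ℕ
  out f w = weight f (λ e → tl e ≡ᵇ w)
  inn f w = weight f (λ e → hd e ≡ᵇ w)

  leaving entering inside : Weight → Subset n → ℕ
  leaving f R = weight f (λ e → mem R (tl e) ∧ not (mem R (hd e)))
  entering f R = weight f (λ e → not (mem R (tl e)) ∧ mem R (hd e))
  inside f R = weight f (λ e → mem R (tl e) ∧ mem R (hd e))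

  Cut : Subset m → Fin n → Fin n → ℕ → Set
  Cut H s t k = Σ (Subset n) λ Y → mem Y s ≡ false × mem Y t ≡ true × entering (ind H) Y ≡ k

  Balanced : Weight → Fin n → Fin n → ℕ → Set
  Balanced f s t k = ∀ w → out f w + ⟦ w ≡ᵇ t ⟧ * k ≡ inn f w + ⟦ w ≡ᵇ s ⟧ * k

  weight-+ : ∀ f g p → weight (λ e → f e + g e) p ≡ weight f p + weight g p
  weight-+ f g p = trans (sum-cong-≗ (λ e → *-distribʳ-+ ⟦ p e ⟧ (f e) (g e)))
                         (∑-distrib-+ (λ e → f e * ⟦ p e ⟧) (λ e → g e * ⟦ p e ⟧))

  weight-cong : ∀ {f g} p → (∀ e → f e ≡ g e) → weight f p ≡ weight g p
  weight-cong p f≗g = sum-cong-≗ (λ e → cong (_* ⟦ p e ⟧) (f≗g e))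

  sum-ends : ∀ f (end : Fin m → Fin n) (h : Fin n → ℕ) →
    sum (λ w → h w * weight f (λ e → end e ≡ᵇ w)) ≡ sum (λ e → f e * h (end e))
  sum-ends f end h = begin
    sum (λ w → h w * sum (λ e → f e * ⟦ end e ≡ᵇ w ⟧))   ≡⟨ sum-cong-≗ (λ w → *-distribˡ-sum (h w) (λ e → f e * ⟦ end e ≡ᵇ w ⟧)) ⟩
    sum (λ w → sum (λ e → h w * (f e * ⟦ end e ≡ᵇ w ⟧)))  ≡⟨ ∑-comm (λ w e → h w * (f e * ⟦ end e ≡ᵇ w ⟧)) ⟩
    sum (λ e → sum (λ w → h w * (f e * ⟦ end e ≡ᵇ w ⟧)))  ≡⟨ sum-cong-≗ (λ e → sum-cong-≗ (λ w → reorder (h w) (f e) (end e) w)) ⟩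
    sum (λ e → sum (λ w → ⟦ w ≡ᵇ end e ⟧ * (f e * h w)))  ≡⟨ sum-cong-≗ (λ e → sum-point (end e) (λ w → f e * h w)) ⟩
    sum (λ e → f e * h (end e))                          ∎
    where
    open ≡-Reasoning
    reorder : ∀ x y (u w : Fin n) → x * (y * ⟦ u ≡ᵇ w ⟧) ≡ ⟦ w ≡ᵇ u ⟧ * (y * x)
    reorder x y u w rewrite ≡ᵇ-sym u w = rearrange x y ⟦ w ≡ᵇ u ⟧
      where
      rearrange : ∀ a b c → a * (b * c) ≡ c * (b * a)
      rearrange = solve-∀

  sum-out-over : ∀ f R → sum (λ w → ⟦ mem R w ⟧ * out f w) ≡ inside f R + leaving f R
  sum-out-over f R =
    trans (sum-ends f tl (λ w → ⟦ mem R w ⟧))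
          (trans (sum-cong-≗ (λ e → trans (cong (f e *_) (⟦⟧-split (mem R (tl e)) (mem R (hd e))))
                                            (*-distribˡ-+ (f e) _ _)))
                 (∑-distrib-+ (λ e → f e * ⟦ mem R (tl e) ∧ mem R (hd e) ⟧)
                              (λ e → f e * ⟦ mem R (tl e) ∧ not (mem R (hd e)) ⟧)))

  sum-inn-over : ∀ f R → sum (λ w → ⟦ mem R w ⟧ * inn f w) ≡ inside f R + entering f R
  sum-inn-over f R =
    trans (sum-ends f hd (λ w → ⟦ mem R w ⟧))
          (trans (sum-cong-≗ (λ e → trans (cong (f e *_) (split-hd (mem R (tl e)) (mem R (hd e))))
                                            (*-distribˡ-+ (f e) _ _)))
                 (∑-distrib-+ (λ e → f e * ⟦ mem R (tl e) ∧ mem R (hd e) ⟧)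
                              (λ e → f e * ⟦ not (mem R (tl e)) ∧ mem R (hd e) ⟧)))
    where
    split-hd : ∀ a b → ⟦ b ⟧ ≡ ⟦ a ∧ b ⟧ + ⟦ not a ∧ b ⟧
    split-hd true b = sym (+-identityʳ ⟦ b ⟧)
    split-hd false b = refl

  cut-balance : ∀ f s t k R → Balanced f s t k → mem R s ≡ true → mem R t ≡ false →
    leaving f R ≡ entering f R + k
  cut-balance f s t k R bal s∈R t∉R = +-cancelˡ-≡ (inside f R) _ _ (begin
    inside f R + leaving f R                                       ≡⟨ sum-out-over f R ⟨
    sum (λ w → ⟦ mem R w ⟧ * out f w)                              ≡⟨ +-identityʳ _ ⟨
    sum (λ w → ⟦ mem R w ⟧ * out f w) + 0 * k                      ≡⟨ cong (λ b → _ + ⟦ b ⟧ * k) t∉R ⟨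
    sum (λ w → ⟦ mem R w ⟧ * out f w) + ⟦ mem R t ⟧ * k            ≡⟨ at t (out f) ⟨
    sum (λ w → ⟦ mem R w ⟧ * (out f w + ⟦ w ≡ᵇ t ⟧ * k))           ≡⟨ sum-cong-≗ (λ w → cong (⟦ mem R w ⟧ *_) (bal w)) ⟩
    sum (λ w → ⟦ mem R w ⟧ * (inn f w + ⟦ w ≡ᵇ s ⟧ * k))           ≡⟨ at s (inn f) ⟩
    sum (λ w → ⟦ mem R w ⟧ * inn f w) + ⟦ mem R s ⟧ * k            ≡⟨ cong₂ _+_ (sum-inn-over f R) (cong (λ b → ⟦ b ⟧ * k) s∈R) ⟩
    (inside f R + entering f R) + 1 * k                            ≡⟨ +-assoc (inside f R) (entering f R) (1 * k) ⟩
    inside f R + (entering f R + 1 * k)                            ≡⟨ cong (λ z → inside f R + (entering f R + z)) (*-identityˡ k) ⟩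
    inside f R + (entering f R + k)                                ∎)
    where
    open ≡-Reasoning
    at : ∀ c (g : Fin n → ℕ) → sum (λ w → ⟦ mem R w ⟧ * (g w + ⟦ w ≡ᵇ c ⟧ * k)) ≡ sum (λ w → ⟦ mem R w ⟧ * g w) + ⟦ mem R c ⟧ * k
    at c g = begin
      sum (λ w → ⟦ mem R w ⟧ * (g w + ⟦ w ≡ᵇ c ⟧ * k))                        ≡⟨ sum-cong-≗ (λ w → *-distribˡ-+ ⟦ mem R w ⟧ (g w) _) ⟩
      sum (λ w → ⟦ mem R w ⟧ * g w + ⟦ mem R w ⟧ * (⟦ w ≡ᵇ c ⟧ * k))          ≡⟨ ∑-distrib-+ (λ w → ⟦ mem R w ⟧ * g w) (λ w → ⟦ mem R w ⟧ * (⟦ w ≡ᵇ c ⟧ * k)) ⟩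
      sum (λ w → ⟦ mem R w ⟧ * g w) + sum (λ w → ⟦ mem R w ⟧ * (⟦ w ≡ᵇ c ⟧ * k))  ≡⟨ cong (sum (λ w → ⟦ mem R w ⟧ * g w) +_) pick ⟩
      sum (λ w → ⟦ mem R w ⟧ * g w) + ⟦ mem R c ⟧ * k                          ∎
      where
      swap-ends : ∀ a b → a * (b * k) ≡ b * (a * k)
      swap-ends a b = trans (sym (*-assoc a b k)) (trans (cong (_* k) (*-comm a b)) (*-assoc b a k))
      pick : sum (λ w → ⟦ mem R w ⟧ * (⟦ w ≡ᵇ c ⟧ * k)) ≡ ⟦ mem R c ⟧ * k
      pick = trans (sum-cong-≗ (λ w → swap-ends ⟦ mem R w ⟧ ⟦ w ≡ᵇ c ⟧)) (sum-point c (λ w → ⟦ mem R w ⟧ * k))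

  augment-value : ∀ f f' a b s t k →
    (∀ e → f' e + b e ≡ f e + a e) →
    (∀ w → out a w + inn b w + ⟦ w ≡ᵇ t ⟧ ≡ inn a w + out b w + ⟦ w ≡ᵇ s ⟧) →
    Balanced f s t k ⇔ Balanced f' s t (suc k)
  augment-value f f' a b s t k edgewise unit =
    mk⇔ (λ bal w → step w (Equivalence.to (at w) (bal w)))
        (λ bal w → Equivalence.from (at w) (unstep w (bal w)))
    where
    ends : ∀ end → (w : Fin n) → weight f' (λ e → end e ≡ᵇ w) + weight b (λ e → end e ≡ᵇ w)
                                ≡ weight f (λ e → end e ≡ᵇ w) + weight a (λ e → end e ≡ᵇ w)
    ends end w = trans (sym (weight-+ f' b _)) (trans (weight-cong _ edgewise) (weight-+ f a _))
    at : ∀ w → (out f w + ⟦ w ≡ᵇ t ⟧ * k ≡ inn f w + ⟦ w ≡ᵇ s ⟧ * k) ⇔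
               (out f' w + (⟦ w ≡ᵇ t ⟧ + ⟦ w ≡ᵇ t ⟧ * k) ≡ inn f' w + (⟦ w ≡ᵇ s ⟧ + ⟦ w ≡ᵇ s ⟧ * k))
    at w = transfer {K = ⟦ w ≡ᵇ t ⟧ * k} {K' = ⟦ w ≡ᵇ s ⟧ * k} (ends tl w) (ends hd w) (unit w)
    step : ∀ w → out f' w + (⟦ w ≡ᵇ t ⟧ + ⟦ w ≡ᵇ t ⟧ * k) ≡ inn f' w + (⟦ w ≡ᵇ s ⟧ + ⟦ w ≡ᵇ s ⟧ * k) →
                 out f' w + ⟦ w ≡ᵇ t ⟧ * suc k ≡ inn f' w + ⟦ w ≡ᵇ s ⟧ * suc k
    step w e = trans (cong (out f' w +_) (*-suc ⟦ w ≡ᵇ t ⟧ k)) (trans e (sym (cong (inn f' w +_) (*-suc ⟦ w ≡ᵇ s ⟧ k))))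
    unstep : ∀ w → out f' w + ⟦ w ≡ᵇ t ⟧ * suc k ≡ inn f' w + ⟦ w ≡ᵇ s ⟧ * suc k →
                   out f' w + (⟦ w ≡ᵇ t ⟧ + ⟦ w ≡ᵇ t ⟧ * k) ≡ inn f' w + (⟦ w ≡ᵇ s ⟧ + ⟦ w ≡ᵇ s ⟧ * k)
    unstep w e = trans (sym (cong (out f' w +_) (*-suc ⟦ w ≡ᵇ t ⟧ k))) (trans e (cong (inn f' w +_) (*-suc ⟦ w ≡ᵇ s ⟧ k)))

isZero : ℕ → Bool
isZero zero = true
isZero (suc _) = false

module Decomposition (G : Digraph) where
  open Digraph G
  open Walks G
  open Reach G
  open Flows G

  weight-zero : ∀ p → weight (λ _ → 0) p ≡ 0
  weight-zero p = sum-zero (λ e → 0 * ⟦ p e ⟧) (λ _ → refl)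

  closed⇒no-leaving : ∀ P R → Closed P R → leaving (ind P) R ≡ 0
  closed⇒no-leaving P R closed = sum-zero (λ e → ⟦ mem P e ⟧ * ⟦ mem R (tl e) ∧ not (mem R (hd e)) ⟧) no-edge
    where
    no-edge : ∀ e → ⟦ mem P e ⟧ * ⟦ mem R (tl e) ∧ not (mem R (hd e)) ⟧ ≡ 0
    no-edge e with mem P e in e∈P | mem R (tl e) in tl∈R
    ... | false | _ = refl
    ... | true | false = refl
    ... | true | true rewrite closed e e∈P tl∈R = refl

  walk-unit : ∀ {A s t L} → IsWalk G A s t L → ∀ w →
    out (count L) w + inn (λ _ → 0) w + ⟦ w ≡ᵇ t ⟧ ≡ inn (count L) w + out (λ _ → 0) w + ⟦ w ≡ᵇ s ⟧
  walk-unit {s = s} {t} {L} walk w = begin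
    out (count L) w + inn (λ _ → 0) w + ⟦ w ≡ᵇ t ⟧  ≡⟨ cong (λ z → out (count L) w + z + ⟦ w ≡ᵇ t ⟧) (weight-zero (λ e → hd e ≡ᵇ w)) ⟩
    out (count L) w + 0 + ⟦ w ≡ᵇ t ⟧                 ≡⟨ cong (_+ ⟦ w ≡ᵇ t ⟧) (+-identityʳ (out (count L) w)) ⟩
    out (count L) w + ⟦ w ≡ᵇ t ⟧                     ≡⟨ walk-conservation walk w ⟩
    inn (count L) w + ⟦ w ≡ᵇ s ⟧                     ≡⟨ cong (_+ ⟦ w ≡ᵇ s ⟧) (+-identityʳ (inn (count L) w)) ⟨
    inn (count L) w + 0 + ⟦ w ≡ᵇ s ⟧                 ≡⟨ cong (λ z → inn (count L) w + z + ⟦ w ≡ᵇ s ⟧) (weight-zero (λ e → tl e ≡ᵇ w)) ⟨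
    inn (count L) w + out (λ _ → 0) w + ⟦ w ≡ᵇ s ⟧  ∎
    where open ≡-Reasoning

  remove : Subset m → List (Fin m) → Subset m
  remove P L = tabulate (λ e → mem P e ∧ isZero (count L e))

  remove-mem : ∀ P L e → mem (remove P L) e ≡ (mem P e ∧ isZero (count L e))
  remove-mem P L e = lookup∘tabulate _ e

  remove-⊆ : ∀ P L → remove P L ⊆ P
  remove-⊆ P L {e} e∈ = mem⇒∈ (proj₁ (∧-true (trans (sym (remove-mem P L e)) (∈⇒mem e∈))))

  remove-disjoint : ∀ P L e → e ∈ remove P L → count L e ≡ 0
  remove-disjoint P L e e∈ with count L e | proj₂ (∧-true {mem P e} (trans (sym (remove-mem P L e)) (∈⇒mem e∈)))
  ... | zero | _ = refl

  remove-path : ∀ {P s t L} → IsPath G P s t L → ∀ e → ⟦ mem P e ⟧ + 0 ≡ ⟦ mem (remove P L) e ⟧ + count L e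
  remove-path {P} {L = L} path e rewrite remove-mem P L e with count L e in c | path-count≤1 path e
  ... | zero | _ = cong (λ b → ⟦ b ⟧ + 0) (sym (∧-identityʳ (mem P e)))
  ... | suc zero | _ rewrite ∈⇒mem (walk-⊆ (proj₁ path) (count≢0⇒∈ {L = L} (λ c≡0 → 0≢1+n (trans (sym c≡0) c)))) = refl
  ... | suc (suc _) | s≤s ()

  decompose : ∀ P s t k → Balanced (ind P) s t k → HasDisjointPaths G P s t k
  decompose P s t zero bal = (λ ()) , (λ ()) , (λ ())
  decompose P s t (suc k) bal with reachable P s
  ... | R , (s∈R , walk-to) , closed with mem R t in t∈R
  ... | false = ⊥-elim (0≢1+n (begin
        0                                 ≡⟨ closed⇒no-leaving P R closed ⟨
        leaving (ind P) R                 ≡⟨ cut-balance (ind P) s t (suc k) R bal s∈R t∈R ⟩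
        entering (ind P) R + suc k        ≡⟨ +-suc _ k ⟩
        suc (entering (ind P) R + k)      ∎))
    where open ≡-Reasoning
  ... | true with walk⇒path (proj₂ (walk-to t t∈R))
  ... | L , path = paths , is-path , disjoint
    where
    P' : Subset m
    P' = remove P L
    -- removing the path lowers the value by one
    bal' : Balanced (ind P') s t k
    bal' = Equivalence.from (augment-value (ind P') (ind P) (count L) (λ _ → 0) s t k
                               (remove-path path) (walk-unit (proj₁ path))) bal
    rest : HasDisjointPaths G P' s t k
    rest = decompose P' s t k bal'
    paths : Fin (suc k) → List (Fin m)
    paths zero = L
    paths (suc i) = proj₁ rest i
    is-path : ∀ i → IsPath G P s t (paths i)
    is-path zero = path
    is-path (suc i) = walk-mono (remove-⊆ P L) (proj₁ (proj₁ (proj₂ rest) i)) , proj₂ (proj₁ (proj₂ rest) i)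
    apart : ∀ j e → e ∈ₗ L → e ∈ₗ proj₁ rest j → ⊥
    apart j e e∈L e∈j = ∈⇒count≢0 e∈L (remove-disjoint P L e (walk-⊆ (proj₁ (proj₁ (proj₂ rest) j)) e∈j))
    disjoint : ∀ i j → i ≢ j → ∀ e → e ∈ₗ paths i → e ∈ₗ paths j → ⊥
    disjoint zero zero 0≢0 = ⊥-elim (0≢0 refl)
    disjoint zero (suc j) _ e e∈i e∈j = apart j e e∈i e∈j
    disjoint (suc i) zero _ e e∈i e∈j = apart i e e∈j e∈i
    disjoint (suc i) (suc j) i≢j = proj₂ (proj₂ rest) i j (i≢j ∘ cong suc)

module Augmentation (G : Digraph) where
  open Digraph G
  open Flows G

  residual : Digraph
  residual = record { n = n ; m = m + m
                    ; tl = λ y → [ tl , hd ]′ (splitAt m y)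
                    ; hd = λ y → [ hd , tl ]′ (splitAt m y) }

  open Walks residual using (walk-⊆; path-count≤1; walk⇒path)
  open Reach residual using (reachable; Closed)

  fwd bwd : Fin m → Fin (m + m)
  fwd x = x ↑ˡ m
  bwd x = m ↑ʳ x

  tl-fwd : ∀ x → Digraph.tl residual (fwd x) ≡ tl x
  tl-fwd x = cong [ tl , hd ]′ (splitAt-↑ˡ m x m)
  hd-fwd : ∀ x → Digraph.hd residual (fwd x) ≡ hd x
  hd-fwd x = cong [ hd , tl ]′ (splitAt-↑ˡ m x m)
  tl-bwd : ∀ x → Digraph.tl residual (bwd x) ≡ hd x
  tl-bwd x = cong [ tl , hd ]′ (splitAt-↑ʳ m m x)
  hd-bwd : ∀ x → Digraph.hd residual (bwd x) ≡ tl x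
  hd-bwd x = cong [ hd , tl ]′ (splitAt-↑ʳ m m x)

  Res : Subset m → Subset m → Subset (m + m)
  Res H P = tabulate (λ y → [ (λ x → mem H x ∧ not (mem P x)) , mem P ]′ (splitAt m y))

  Res-fwd : ∀ H P x → mem (Res H P) (fwd x) ≡ (mem H x ∧ not (mem P x))
  Res-fwd H P x = trans (lookup∘tabulate _ (fwd x)) (cong [ (λ x → mem H x ∧ not (mem P x)) , mem P ]′ (splitAt-↑ˡ m x m))
  Res-bwd : ∀ H P x → mem (Res H P) (bwd x) ≡ mem P x
  Res-bwd H P x = trans (lookup∘tabulate _ (bwd x)) (cong [ (λ x → mem H x ∧ not (mem P x)) , mem P ]′ (splitAt-↑ʳ m m x))

  blocked⇒cut : ∀ H P s t k → P ⊆ H → Balanced (ind P) s t k →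
    ∀ R → mem R s ≡ true → mem R t ≡ false → Closed (Res H P) R → Cut H s t k
  blocked⇒cut H P s t k P⊆H bal R s∈R t∉R closed = Y , Y-s , Y-t , size
    where
    Y = ∁ R
    Y-mem : ∀ w → mem Y w ≡ not (mem R w)
    Y-mem w = lookup-map w not R
    Y-s : mem Y s ≡ false
    Y-s = trans (Y-mem s) (cong not s∈R)
    Y-t : mem Y t ≡ true
    Y-t = trans (Y-mem t) (cong not t∉R)
    -- a forward residual edge cannot leave R, so H-edges leaving R are flow edges
    leaving-in-P : ∀ x → ⟦ mem H x ⟧ * ⟦ not (mem Y (tl x)) ∧ mem Y (hd x) ⟧ ≡ ⟦ mem P x ⟧ * ⟦ mem R (tl x) ∧ not (mem R (hd x)) ⟧
    leaving-in-P x rewrite Y-mem (tl x) | Y-mem (hd x) | not-involutive (mem R (tl x))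
      with mem R (tl x) in tl∈R | mem R (hd x) in hd∈R
    ... | false | _ = trans (*-zeroʳ ⟦ mem H x ⟧) (sym (*-zeroʳ ⟦ mem P x ⟧))
    ... | true | true = trans (*-zeroʳ ⟦ mem H x ⟧) (sym (*-zeroʳ ⟦ mem P x ⟧))
    ... | true | false with mem P x in x∈P
    ...   | true = cong (λ b → ⟦ b ⟧ * 1) (∈⇒mem (P⊆H (mem⇒∈ x∈P)))
    ...   | false with mem H x in x∈H
    ...     | false = refl
    ...     | true = ⊥-elim (true≢false (trans (sym (closed (fwd x) res (trans (cong (mem R) (tl-fwd x)) tl∈R)))
                                             (trans (cong (mem R) (hd-fwd x)) hd∈R)))
      where
      res : mem (Res H P) (fwd x) ≡ true
      res = trans (Res-fwd H P x) (cong₂ (λ a b → a ∧ not b) x∈H x∈P)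
    -- a backward residual edge cannot leave R, so no flow edge enters R
    entering-none : ∀ x → ⟦ mem P x ⟧ * ⟦ not (mem R (tl x)) ∧ mem R (hd x) ⟧ ≡ 0
    entering-none x with mem P x in x∈P | mem R (hd x) in hd∈R | mem R (tl x) in tl∈R
    ... | false | _ | _ = refl
    ... | true | false | _ = cong (λ b → ⟦ b ⟧ + 0) (∧-zeroʳ _)
    ... | true | true | true = refl
    ... | true | true | false = ⊥-elim (true≢false (trans (sym (closed (bwd x) (trans (Res-bwd H P x) x∈P) (trans (cong (mem R) (tl-bwd x)) hd∈R)))
                                                         (trans (cong (mem R) (hd-bwd x)) tl∈R)))
    size : entering (ind H) Y ≡ k
    size = begin
      entering (ind H) Y          ≡⟨ sum-cong-≗ leaving-in-P ⟩
      leaving (ind P) R           ≡⟨ cut-balance (ind P) s t k R bal s∈R t∉R ⟩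
      entering (ind P) R + k      ≡⟨ cong (_+ k) (sum-zero _ entering-none) ⟩
      k                           ∎
      where open ≡-Reasoning

  module AugmentAlong (H P : Subset m) (P⊆H : P ⊆ H) (s t : Fin n) {L : List (Fin (m + m))}
                      (path : IsPath residual (Res H P) s t L) where
    forward backward : Weight
    forward x = count L (fwd x)
    backward x = count L (bwd x)

    P' : Subset m
    P' = tabulate (λ x → (mem P x ∧ isZero (backward x)) ∨ not (isZero (forward x)))

    P'-mem : ∀ x → mem P' x ≡ ((mem P x ∧ isZero (backward x)) ∨ not (isZero (forward x)))
    P'-mem x = lookup∘tabulate _ x

    on-path : ∀ y → count L y ≢ 0 → mem (Res H P) y ≡ true
    on-path y c≢0 = ∈⇒mem (walk-⊆ (proj₁ path) (count≢0⇒∈ {L = L} c≢0))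

    forward-unused : ∀ x → forward x ≢ 0 → (mem H x ∧ not (mem P x)) ≡ true
    forward-unused x c≢0 = trans (sym (Res-fwd H P x)) (on-path (fwd x) c≢0)

    backward-used : ∀ x → backward x ≢ 0 → mem P x ≡ true
    backward-used x c≢0 = trans (sym (Res-bwd H P x)) (on-path (bwd x) c≢0)

    suc≢0 : ∀ {c k} → c ≡ suc k → c ≢ 0
    suc≢0 c≡suc c≡0 = 0≢1+n (trans (sym c≡0) c≡suc)

    edgewise : ∀ x → ⟦ mem P' x ⟧ + backward x ≡ ⟦ mem P x ⟧ + forward x
    edgewise x rewrite P'-mem x with forward x in f | backward x in b
                                   | path-count≤1 path (fwd x) | path-count≤1 path (bwd x)
    ... | suc (suc _) | _ | s≤s () | _
    ... | _ | suc (suc _) | _ | s≤s ()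
    ... | zero | zero | _ | _ = cong (λ z → ⟦ z ⟧ + 0) (trans (∨-identityʳ _) (∧-identityʳ (mem P x)))
    ... | zero | suc zero | _ | _ rewrite backward-used x (suc≢0 b) = refl
    ... | suc zero | zero | _ | _ rewrite not-true (proj₂ (∧-true {mem H x} (forward-unused x (suc≢0 f)))) = refl
    ... | suc zero | suc zero | _ | _ =
      ⊥-elim (true≢false (trans (sym (backward-used x (suc≢0 b))) (not-true (proj₂ (∧-true {mem H x} (forward-unused x (suc≢0 f)))))))

    P'⊆H : P' ⊆ H
    P'⊆H {x} x∈P' with forward x in f
    ... | suc _ = mem⇒∈ (proj₁ (∧-true (forward-unused x (suc≢0 f))))
    ... | zero = P⊆H (mem⇒∈ (proj₁ (∧-true (trans (sym (∨-identityʳ _)) x∈P'-mem))))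
      where
      x∈P'-mem : ((mem P x ∧ isZero (backward x)) ∨ false) ≡ true
      x∈P'-mem = trans (cong (λ c → (mem P x ∧ isZero (backward x)) ∨ not (isZero c)) (sym f))
                       (trans (sym (P'-mem x)) (∈⇒mem x∈P'))

    split : ∀ (end : Fin (m + m) → Fin n) (end₁ end₂ : Fin m → Fin n) →
      (∀ x → end (fwd x) ≡ end₁ x) → (∀ x → end (bwd x) ≡ end₂ x) → ∀ w →
      sum (λ y → count L y * ⟦ end y ≡ᵇ w ⟧) ≡ weight forward (λ x → end₁ x ≡ᵇ w) + weight backward (λ x → end₂ x ≡ᵇ w)
    split end end₁ end₂ at-fwd at-bwd w =
      trans (sum-split m m _)
            (cong₂ _+_ (sum-cong-≗ (λ x → cong (λ v → forward x * ⟦ v ≡ᵇ w ⟧) (at-fwd x)))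
                       (sum-cong-≗ (λ x → cong (λ v → backward x * ⟦ v ≡ᵇ w ⟧) (at-bwd x))))

    unit : ∀ w → out forward w + inn backward w + ⟦ w ≡ᵇ t ⟧ ≡ inn forward w + out backward w + ⟦ w ≡ᵇ s ⟧
    unit w = begin
      out forward w + inn backward w + ⟦ w ≡ᵇ t ⟧                                   ≡⟨ cong (_+ ⟦ w ≡ᵇ t ⟧) (split (Digraph.tl residual) tl hd tl-fwd tl-bwd w) ⟨
      sum (λ y → count L y * ⟦ Digraph.tl residual y ≡ᵇ w ⟧) + ⟦ w ≡ᵇ t ⟧          ≡⟨ Walks.walk-conservation residual (proj₁ path) w ⟩
      sum (λ y → count L y * ⟦ Digraph.hd residual y ≡ᵇ w ⟧) + ⟦ w ≡ᵇ s ⟧          ≡⟨ cong (_+ ⟦ w ≡ᵇ s ⟧) (split (Digraph.hd residual) hd tl hd-fwd hd-bwd w) ⟩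
      inn forward w + out backward w + ⟦ w ≡ᵇ s ⟧                                   ∎
      where open ≡-Reasoning

    augmented : ∀ k → Balanced (ind P) s t k → Balanced (ind P') s t (suc k)
    augmented k = Equivalence.to (augment-value (ind P) (ind P') forward backward s t k edgewise unit)

  augment : ∀ H P s t k → P ⊆ H → Balanced (ind P) s t k →
    (Σ (Subset m) λ P' → P' ⊆ H × Balanced (ind P') s t (suc k)) ⊎ Cut H s t k
  augment H P s t k P⊆H bal with reachable (Res H P) s
  ... | R , (s∈R , walk-to) , closed with mem R t in t∈R
  ... | false = inj₂ (blocked⇒cut H P s t k P⊆H bal R s∈R t∈R closed)
  ... | true with walk⇒path (proj₂ (walk-to t t∈R))
  ... | L , path = inj₁ (P' , P'⊆H , augmented k bal)
    where open AugmentAlong H P P⊆H s t path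

module Menger (G : Digraph) where
  open Digraph G
  open Walks G
  open Flows G
  open Decomposition G
  open Augmentation G

  paths-mono : ∀ {A B s t k} → A ⊆ B → HasDisjointPaths G A s t k → HasDisjointPaths G B s t k
  paths-mono A⊆B (P , is-path , disjoint) = P , (λ i → walk-mono A⊆B (proj₁ (is-path i)) , proj₂ (is-path i)) , disjoint

  paths-fewer : ∀ {H s t j k} → j ≤ k → HasDisjointPaths G H s t k → HasDisjointPaths G H s t j
  paths-fewer j≤k (P , is-path , disjoint) =
    (λ i → P (Fin.inject≤ i j≤k)) , (λ i → is-path _) ,
    (λ i i' i≢i' → disjoint _ _ (i≢i' ∘ inject≤-injective j≤k j≤k i i'))

  -- A flow of value k between distinct vertices uses at least k edges, so k ≤ m.
  flow-value≤m : ∀ P s t k → s ≢ t → Balanced (ind P) s t k → k ≤ m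
  flow-value≤m P s t k s≢t bal = begin
    k                       ≤⟨ m≤n+m k (out (ind P) t) ⟩
    out (ind P) t + k       ≡⟨ cong (out (ind P) t +_) (*-identityˡ k) ⟨
    out (ind P) t + 1 * k   ≡⟨ cong (λ b → out (ind P) t + ⟦ b ⟧ * k) (≡ᵇ-refl t) ⟨
    out (ind P) t + ⟦ t ≡ᵇ t ⟧ * k  ≡⟨ bal t ⟩
    inn (ind P) t + ⟦ t ≡ᵇ s ⟧ * k  ≡⟨ cong (λ b → inn (ind P) t + ⟦ b ⟧ * k) (≡ᵇ-≢ (s≢t ∘ sym)) ⟩
    inn (ind P) t + 0       ≡⟨ +-identityʳ _ ⟩
    inn (ind P) t           ≤⟨ sum-mono (λ e → *-mono-≤ (⟦⟧≤1 (mem P e)) (⟦⟧≤1 (hd e ≡ᵇ t))) ⟩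
    sum {m} (λ _ → 1)       ≡⟨ sum-one m ⟩
    m                       ∎
    where open ≤-Reasoning

  -- Menger's theorem: for s ≠ t there are k edge-disjoint s-t paths in H and an s-t cut of H of size k.
  -- Augment the empty flow until a cut appears; the value is bounded by m.
  menger : ∀ H s t → s ≢ t → Σ ℕ λ k → HasDisjointPaths G H s t k × Cut H s t k
  menger H s t s≢t = grow (suc m) 0 ∅ (⊆-min H) empty-flow refl
    where
    empty-flow : Balanced (ind ∅) s t 0
    empty-flow w = trans (cong₂ _+_ (no-edges tl) (*-zeroʳ ⟦ w ≡ᵇ t ⟧))
                         (sym (cong₂ _+_ (no-edges hd) (*-zeroʳ ⟦ w ≡ᵇ s ⟧)))
      where
      no-edges : ∀ end → weight (ind ∅) (λ e → end e ≡ᵇ w) ≡ 0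
      no-edges end = sum-zero (λ e → ⟦ mem ∅ e ⟧ * ⟦ end e ≡ᵇ w ⟧) (λ e → cong (λ b → ⟦ b ⟧ * ⟦ end e ≡ᵇ w ⟧) (lookup-replicate e false))
    grow : ∀ fuel k P → P ⊆ H → Balanced (ind P) s t k → k + fuel ≡ suc m →
           Σ ℕ λ k → HasDisjointPaths G H s t k × Cut H s t k
    grow zero k P P⊆H bal k≡ = ⊥-elim (<⇒≱ (≤-reflexive (trans (sym k≡) (+-identityʳ k))) (flow-value≤m P s t k s≢t bal))
    grow (suc fuel) k P P⊆H bal k≡ with augment H P s t k P⊆H bal
    ... | inj₁ (P' , P'⊆H , bal') = grow fuel (suc k) P' P'⊆H bal' (trans (sym (+-suc k fuel)) k≡)
    ... | inj₂ cut = k , paths-mono P⊆H (decompose P s t k bal) , cut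

module Duality (G : Digraph) where
  open Digraph G
  open Flows G
  open Menger G

  Enters : Subset m → Subset n → Fin m → Bool
  Enters H Y e = mem H e ∧ not (mem Y (tl e)) ∧ mem Y (hd e)

  entering-ind : ∀ H Y → entering (ind H) Y ≡ sum (λ e → ⟦ Enters H Y e ⟧)
  entering-ind H Y = sym (sum-cong-≗ (λ e → ⟦∧⟧ (mem H e) _))

  walk-enters : ∀ {H x y L} (Y : Subset n) → IsWalk G H x y L → mem Y x ≡ false → mem Y y ≡ true →
    Σ (Fin m) λ e → e ∈ₗ L × Enters H Y e ≡ true
  walk-enters Y [] x∉Y y∈Y = ⊥-elim (true≢false (trans (sym y∈Y) x∉Y))
  walk-enters {H} {L = e ∷ L} Y ((refl , e∈H) ∷ rest) x∉Y y∈Y with mem Y (hd e) in hd∈Y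
  ... | true = e , here refl , trans (cong₂ (λ a b → a ∧ not b ∧ mem Y (hd e)) (∈⇒mem e∈H) x∉Y) hd∈Y
  ... | false with walk-enters Y rest hd∈Y y∈Y
  ...   | e' , e'∈L , enters = e' , there e'∈L , enters

  -- Weak duality: k edge-disjoint s-t paths cross every s-t cut through k distinct edges.
  paths≤cut : ∀ {H s t k} (Y : Subset n) → HasDisjointPaths G H s t k →
    mem Y s ≡ false → mem Y t ≡ true → k ≤ entering (ind H) Y
  paths≤cut {H} Y (P , is-path , disjoint) s∉Y t∈Y =
    subst (_ ≤_) (sym (entering-ind H Y)) (count-injection (Enters H Y) crossing-edge distinct (proj₂ ∘ proj₂ ∘ crossing))
    where
    crossing : ∀ i → Σ (Fin m) λ e → e ∈ₗ P i × Enters H Y e ≡ true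
    crossing i = walk-enters Y (proj₁ (is-path i)) s∉Y t∈Y
    crossing-edge : Fin _ → Fin m
    crossing-edge i = proj₁ (crossing i)
    distinct : ∀ i j → crossing-edge i ≡ crossing-edge j → i ≡ j
    distinct i j same with i Fin.≟ j
    ... | yes i≡j = i≡j
    ... | no i≢j = ⊥-elim (disjoint i j i≢j _ (proj₁ (proj₂ (crossing i)))
                                          (subst (_∈ₗ P j) (sym same) (proj₁ (proj₂ (crossing j)))))

  lambda-witness : ∀ {H s t k₀} → HasDisjointPaths G H s t k₀ → Cut H s t k₀ →
    ∀ k → IsLambda G H s t k ⇔ (k ≡ k₀)
  lambda-witness {H} {s} {t} {k₀} paths₀ (Y , s∉Y , t∈Y , size) k = mk⇔ to from
    where
    ≤k₀ : ∀ {j} → HasDisjointPaths G H s t j → j ≤ k₀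
    ≤k₀ paths = ≤-trans (paths≤cut Y paths s∉Y t∈Y) (≤-reflexive size)
    to : IsLambda G H s t k → k ≡ k₀
    to (paths , no-more) with k₀ ≤? k
    ... | yes k₀≤k = ≤-antisym (≤k₀ paths) k₀≤k
    ... | no k₀≰k = ⊥-elim (no-more (paths-fewer (≰⇒> k₀≰k) paths₀))
    from : k ≡ k₀ → IsLambda G H s t k
    from refl = paths₀ , (λ more → 1+n≰n (≤k₀ more))

  lambda-menger : ∀ H s t → s ≢ t → Σ ℕ λ k₀ → HasDisjointPaths G H s t k₀ × Cut H s t k₀ × (∀ k → IsLambda G H s t k ⇔ (k ≡ k₀))
  lambda-menger H s t s≢t with menger H s t s≢t
  ... | k₀ , paths , cut = k₀ , paths , cut , lambda-witness paths cut

module Degrees (G : Digraph) where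
  open Digraph G
  open Flows G

  indeg≡inn : ∀ H v → indeg G H v ≡ inn (ind H) v
  indeg≡inn H v = trans (length-filter-sum (λ e → (e ∈? H) ×-dec (hd e Fin.≟ v)) id)
                        (sum-cong-≗ (λ e → trans (cong (λ b → ⟦ b ∧ (hd e ≡ᵇ v) ⟧) (does-∈? e H)) (⟦∧⟧ (mem H e) _)))

  -- every edge has exactly one head, so the in-degrees add up to the number of edges
  sum-inn : ∀ H → sum (λ v → inn (ind H) v) ≡ ∣ H ∣
  sum-inn H = begin
    sum (λ v → inn (ind H) v)          ≡⟨ sum-cong-≗ (λ v → *-identityˡ (inn (ind H) v)) ⟨
    sum (λ v → 1 * inn (ind H) v)      ≡⟨ sum-ends (ind H) hd (λ _ → 1) ⟩
    sum (λ e → ⟦ mem H e ⟧ * 1)         ≡⟨ sum-cong-≗ (λ e → *-identityʳ ⟦ mem H e ⟧) ⟩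
    sum (λ e → ⟦ mem H e ⟧)             ≡⟨ card-sum H ⟨
    ∣ H ∣                               ∎
    where open ≡-Reasoning

  weight-insert : ∀ F e → mem F e ≡ false → ∀ p → weight (ind (F ∪ ⁅ e ⁆)) p ≡ weight (ind F) p + ⟦ p e ⟧
  weight-insert F e e∉F p = begin
    weight (ind (F ∪ ⁅ e ⁆)) p                          ≡⟨ sum-cong-≗ pointwise ⟩
    sum (λ x → ⟦ mem F x ⟧ * ⟦ p x ⟧ + ⟦ x ≡ᵇ e ⟧ * ⟦ p x ⟧)  ≡⟨ ∑-distrib-+ (λ x → ⟦ mem F x ⟧ * ⟦ p x ⟧) (λ x → ⟦ x ≡ᵇ e ⟧ * ⟦ p x ⟧) ⟩
    weight (ind F) p + sum (λ x → ⟦ x ≡ᵇ e ⟧ * ⟦ p x ⟧)    ≡⟨ cong (weight (ind F) p +_) (sum-point e (λ x → ⟦ p x ⟧)) ⟩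
    weight (ind F) p + ⟦ p e ⟧                          ∎
    where
    open ≡-Reasoning
    disjoint-∨ : ∀ x → ⟦ mem F x ∨ (x ≡ᵇ e) ⟧ ≡ ⟦ mem F x ⟧ + ⟦ x ≡ᵇ e ⟧
    disjoint-∨ x with x Fin.≟ e
    ... | yes refl rewrite e∉F = refl
    ... | no _ = trans (cong ⟦_⟧ (∨-identityʳ (mem F x))) (sym (+-identityʳ _))
    pointwise : ∀ x → ⟦ mem (F ∪ ⁅ e ⁆) x ⟧ * ⟦ p x ⟧ ≡ ⟦ mem F x ⟧ * ⟦ p x ⟧ + ⟦ x ≡ᵇ e ⟧ * ⟦ p x ⟧
    pointwise x = trans (cong (λ b → ⟦ b ⟧ * ⟦ p x ⟧) (mem-∪⁅⁆ F e x))
                        (trans (cong (_* ⟦ p x ⟧) (disjoint-∨ x)) (*-distribʳ-+ ⟦ p x ⟧ ⟦ mem F x ⟧ _))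

  entering-submodular : ∀ f A B → entering f (A ∪ B) + entering f (A ∩ B) ≤ entering f A + entering f B
  entering-submodular f A B = begin
    entering f (A ∪ B) + entering f (A ∩ B)  ≡⟨ ∑-distrib-+ (λ e → f e * ⟦ enters (A ∪ B) e ⟧) (λ e → f e * ⟦ enters (A ∩ B) e ⟧) ⟨
    sum (λ e → f e * ⟦ enters (A ∪ B) e ⟧ + f e * ⟦ enters (A ∩ B) e ⟧)  ≤⟨ sum-mono pointwise ⟩
    sum (λ e → f e * ⟦ enters A e ⟧ + f e * ⟦ enters B e ⟧)  ≡⟨ ∑-distrib-+ (λ e → f e * ⟦ enters A e ⟧) (λ e → f e * ⟦ enters B e ⟧) ⟩
    entering f A + entering f B              ∎
    where
    open ≤-Reasoning
    enters : Subset n → Fin m → Bool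
    enters Y e = not (mem Y (tl e)) ∧ mem Y (hd e)
    indicator : ∀ a b a' b' → ⟦ not (a ∨ b) ∧ (a' ∨ b') ⟧ + ⟦ not (a ∧ b) ∧ (a' ∧ b') ⟧ ≤ ⟦ not a ∧ a' ⟧ + ⟦ not b ∧ b' ⟧
    indicator true true _ _ = z≤n
    indicator true false a' b' = ≤-trans (≤-reflexive (+-identityˡ _)) (⟦∧⟧≤ʳ a' b')
    indicator false true a' b' = ≤-trans (≤-reflexive (+-identityˡ _)) (≤-trans (⟦∧⟧≤ˡ a' b') (≤-reflexive (sym (+-identityʳ _))))
    indicator false false a' b' = ≤-reflexive (⟦∨⟧+⟦∧⟧ a' b')
    pointwise : ∀ e → f e * ⟦ enters (A ∪ B) e ⟧ + f e * ⟦ enters (A ∩ B) e ⟧ ≤ f e * ⟦ enters A e ⟧ + f e * ⟦ enters B e ⟧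
    pointwise e rewrite sym (*-distribˡ-+ (f e) ⟦ enters (A ∪ B) e ⟧ ⟦ enters (A ∩ B) e ⟧)
                      | sym (*-distribˡ-+ (f e) ⟦ enters A e ⟧ ⟦ enters B e ⟧)
                      | mem-∪ A B (tl e) | mem-∪ A B (hd e) | mem-∩ A B (tl e) | mem-∩ A B (hd e)
      = *-monoʳ-≤ (f e) (indicator (mem A (tl e)) (mem B (tl e)) (mem A (hd e)) (mem B (hd e)))

module Flames (D : Digraph) (r : Fin (Digraph.n D))
              (no-loop : ∀ e → Digraph.tl D e ≢ Digraph.hd D e)
              (no-edge-into-r : ∀ e → Digraph.hd D e ≢ r) where
  open Digraph D
  open Flows D
  open Degrees D
  open Duality D

  ϱ : Subset m → Fin n → ℕ
  ϱ F v = inn (ind F) v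

  ϱ⁻ : Subset m → Subset n → ℕ
  ϱ⁻ F Y = entering (ind F) Y

  Around : Fin n → Subset n → Set
  Around v Y = mem Y r ≡ false × mem Y v ≡ true

  CutCondition : Subset m → Set
  CutCondition F = ∀ v → v ≢ r → ∀ Y → Around v Y → ϱ F v ≤ ϱ⁻ F Y

  Tight : Subset m → Fin n → Subset n → Set
  Tight F v T = Around v T × ϱ⁻ F T ≤ ϱ F v

  ϱ-at-r : ∀ F → ϱ F r ≡ 0
  ϱ-at-r F = sum-zero _ (λ e → trans (cong (λ b → ⟦ mem F e ⟧ * ⟦ b ⟧) (≡ᵇ-≢ (no-edge-into-r e))) (*-zeroʳ ⟦ mem F e ⟧))

  singleton-around : ∀ v → v ≢ r → Around v ⁅ v ⁆
  singleton-around v v≢r = trans (mem-⁅⁆ v r) (≡ᵇ-≢ (v≢r ∘ sym)) , trans (mem-⁅⁆ v v) (≡ᵇ-refl v)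

  -- {v} is entered exactly by the edges with head v (there are no loops)
  ϱ⁻-singleton : ∀ F v → ϱ⁻ F ⁅ v ⁆ ≡ ϱ F v
  ϱ⁻-singleton F v = sum-cong-≗ pointwise
    where
    pointwise : ∀ e → ⟦ mem F e ⟧ * ⟦ not (mem ⁅ v ⁆ (tl e)) ∧ mem ⁅ v ⁆ (hd e) ⟧ ≡ ⟦ mem F e ⟧ * ⟦ hd e ≡ᵇ v ⟧
    pointwise e rewrite mem-⁅⁆ v (tl e) | mem-⁅⁆ v (hd e) with hd e Fin.≟ v
    ... | no _ = cong (λ b → ⟦ mem F e ⟧ * ⟦ b ⟧) (∧-zeroʳ _)
    ... | yes refl rewrite ≡ᵇ-≢ (no-loop e) = refl

  -- F is an r-flame iff it satisfies the cut condition (via Menger's theorem).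
  flame⇒cut-condition : ∀ F → IsFlame D r F → CutCondition F
  flame⇒cut-condition F flame v v≢r Y (r∉Y , v∈Y) =
    subst (_≤ ϱ⁻ F Y) (indeg≡inn F v) (paths≤cut Y (proj₁ (flame v v≢r)) r∉Y v∈Y)

  cut-condition⇒flame : ∀ F → CutCondition F → IsFlame D r F
  cut-condition⇒flame F cc v v≢r with lambda-menger F r v (v≢r ∘ sym)
  ... | k₀ , paths , (Y , r∉Y , v∈Y , size) , lambda = Equivalence.from (lambda (indeg D F v)) (trans (indeg≡inn F v) ϱ≡k₀)
    where
    ϱ≡k₀ : ϱ F v ≡ k₀
    ϱ≡k₀ = ≤-antisym (≤-trans (cc v v≢r Y (r∉Y , v∈Y)) (≤-reflexive size))
                     (≤-trans (paths≤cut ⁅ v ⁆ paths (proj₁ (singleton-around v v≢r)) (proj₂ (singleton-around v v≢r)))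
                              (≤-reflexive (ϱ⁻-singleton F v)))

  -- Uncrossing: if T is tight for v, Y tight for b and b ∈ T, then T ∪ Y is tight for v.
  -- Submodularity plus the cut condition at b for T ∩ Y.
  tight-∪ : ∀ F → CutCondition F → ∀ {v b T Y} → Tight F v T → Tight F b Y → mem T b ≡ true → Tight F v (T ∪ Y)
  tight-∪ F cc {v} {b} {T} {Y} ((r∉T , v∈T) , T-tight) ((r∉Y , b∈Y) , Y-tight) b∈T =
    (r∉T∪Y , v∈T∪Y) , +-cancelʳ-≤ (ϱ F b) (ϱ⁻ F (T ∪ Y)) (ϱ F v) (begin
      ϱ⁻ F (T ∪ Y) + ϱ F b               ≤⟨ +-monoʳ-≤ (ϱ⁻ F (T ∪ Y)) (cc b b≢r (T ∩ Y) (r∉T∩Y , b∈T∩Y)) ⟩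
      ϱ⁻ F (T ∪ Y) + ϱ⁻ F (T ∩ Y)        ≤⟨ entering-submodular (ind F) T Y ⟩
      ϱ⁻ F T + ϱ⁻ F Y                    ≤⟨ +-mono-≤ T-tight Y-tight ⟩
      ϱ F v + ϱ F b                      ∎)
    where
    open ≤-Reasoning
    b≢r : b ≢ r
    b≢r b≡r = true≢false (trans (sym b∈Y) (trans (cong (mem Y) b≡r) r∉Y))
    r∉T∪Y : mem (T ∪ Y) r ≡ false
    r∉T∪Y = trans (mem-∪ T Y r) (cong₂ _∨_ r∉T r∉Y)
    v∈T∪Y : mem (T ∪ Y) v ≡ true
    v∈T∪Y = trans (mem-∪ T Y v) (cong (_∨ mem Y v) v∈T)
    r∉T∩Y : mem (T ∩ Y) r ≡ false
    r∉T∩Y = trans (mem-∩ T Y r) (cong (_∧ mem Y r) r∉T)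
    b∈T∩Y : mem (T ∩ Y) b ≡ true
    b∈T∩Y = trans (mem-∩ T Y b) (cong₂ _∧_ b∈T b∈Y)

  Blocked : Subset m → Fin m → Set
  Blocked F e = Σ (Subset n) λ Y → Tight F (hd e) Y × mem Y (tl e) ≡ true

  module AddEdge (F : Subset m) (e : Fin m) (e∉F : mem F e ≡ false) where
    F' : Subset m
    F' = F ∪ ⁅ e ⁆
    b : Fin n
    b = hd e

    ϱ-insert : ∀ w → ϱ F' w ≡ ϱ F w + ⟦ hd e ≡ᵇ w ⟧
    ϱ-insert w = weight-insert F e e∉F (λ x → hd x ≡ᵇ w)

    ϱ⁻-insert : ∀ Y → ϱ⁻ F' Y ≡ ϱ⁻ F Y + ⟦ not (mem Y (tl e)) ∧ mem Y (hd e) ⟧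
    ϱ⁻-insert Y = weight-insert F e e∉F (λ x → not (mem Y (tl x)) ∧ mem Y (hd x))

    ϱ⁻-grows : ∀ Y → ϱ⁻ F Y ≤ ϱ⁻ F' Y
    ϱ⁻-grows Y = ≤-trans (m≤m+n _ _) (≤-reflexive (sym (ϱ⁻-insert Y)))

    -- A blocked edge cannot be added: its head would need one more entering edge than the tight set offers.
    blocked⇒not-flame : Blocked F e → ¬ IsFlame D r F'
    blocked⇒not-flame (Y , ((r∉Y , b∈Y) , tight) , tl∈Y) flame' = 1+n≰n (begin
      suc (ϱ F b)                                         ≡⟨ +-comm 1 (ϱ F b) ⟩
      ϱ F b + 1                                           ≡⟨ cong (λ z → ϱ F b + ⟦ z ⟧) (≡ᵇ-refl b) ⟨
      ϱ F b + ⟦ b ≡ᵇ b ⟧                                  ≡⟨ ϱ-insert b ⟨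
      ϱ F' b                                              ≤⟨ flame⇒cut-condition F' flame' b (no-edge-into-r e) Y (r∉Y , b∈Y) ⟩
      ϱ⁻ F' Y                                             ≡⟨ ϱ⁻-insert Y ⟩
      ϱ⁻ F Y + ⟦ not (mem Y (tl e)) ∧ mem Y b ⟧           ≡⟨ cong (λ z → ϱ⁻ F Y + ⟦ not z ∧ mem Y b ⟧) tl∈Y ⟩
      ϱ⁻ F Y + 0                                          ≡⟨ +-identityʳ _ ⟩
      ϱ⁻ F Y                                              ≤⟨ tight ⟩
      ϱ F b                                               ∎)
      where open ≤-Reasoning

    -- Adding an edge to a flame: the result is a flame, or the edge is blocked.
    -- Compare ϱ_F(b) + 1 with λ_F'(r, b) for b = hd e, using a minimum cut Y of F'.
    extend : CutCondition F → IsFlame D r F' ⊎ Blocked F e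
    extend cc with Menger.menger D F' r b (no-edge-into-r e ∘ sym)
    ... | k₀ , paths , (Y , r∉Y , b∈Y , size) with suc (ϱ F b) ≤? k₀
    ... | yes room = inj₁ (cut-condition⇒flame F' cc')
      where
      cc' : CutCondition F'
      cc' w w≢r Y' around with w Fin.≟ b
      ... | yes refl = begin
        ϱ F' b                  ≡⟨ ϱ-insert b ⟩
        ϱ F b + ⟦ b ≡ᵇ b ⟧      ≡⟨ cong (λ z → ϱ F b + ⟦ z ⟧) (≡ᵇ-refl b) ⟩
        ϱ F b + 1               ≡⟨ +-comm (ϱ F b) 1 ⟩
        suc (ϱ F b)             ≤⟨ room ⟩
        k₀                      ≤⟨ paths≤cut Y' paths (proj₁ around) (proj₂ around) ⟩
        ϱ⁻ F' Y'                ∎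
        where open ≤-Reasoning
      ... | no w≢b = begin
        ϱ F' w                  ≡⟨ ϱ-insert w ⟩
        ϱ F w + ⟦ b ≡ᵇ w ⟧      ≡⟨ cong (λ z → ϱ F w + ⟦ z ⟧) (≡ᵇ-≢ (w≢b ∘ sym)) ⟩
        ϱ F w + 0               ≡⟨ +-identityʳ _ ⟩
        ϱ F w                   ≤⟨ cc w w≢r Y' around ⟩
        ϱ⁻ F Y'                 ≤⟨ ϱ⁻-grows Y' ⟩
        ϱ⁻ F' Y'                ∎
        where open ≤-Reasoning
    ... | no no-room = inj₂ (Y , ((r∉Y , b∈Y) , ≤-trans (ϱ⁻-grows Y) (≤-trans (≤-reflexive size) k₀≤ϱ)) , tl∈Y)
      where
      k₀≤ϱ : k₀ ≤ ϱ F b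
      k₀≤ϱ = ≤-pred (≰⇒> no-room)
      -- if e entered Y, Y would be entered by more than ϱ_F(b) ≥ k₀ edges of F'
      tl∈Y : mem Y (tl e) ≡ true
      tl∈Y with mem Y (tl e) in tl∉Y
      ... | true = refl
      ... | false = ⊥-elim (1+n≰n (begin
        suc (ϱ F b)                                    ≤⟨ s≤s (cc b (no-edge-into-r e) Y (r∉Y , b∈Y)) ⟩
        suc (ϱ⁻ F Y)                                   ≡⟨ +-comm 1 (ϱ⁻ F Y) ⟩
        ϱ⁻ F Y + ⟦ not false ∧ true ⟧                  ≡⟨ cong₂ (λ p q → ϱ⁻ F Y + ⟦ not p ∧ q ⟧) tl∉Y b∈Y ⟨
        ϱ⁻ F Y + ⟦ not (mem Y (tl e)) ∧ mem Y b ⟧      ≡⟨ ϱ⁻-insert Y ⟨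
        ϱ⁻ F' Y                                        ≡⟨ size ⟩
        k₀                                             ≤⟨ k₀≤ϱ ⟩
        ϱ F b                                          ∎))
        where open ≤-Reasoning

  ϱ⁻-dominated : ∀ C F T → (∀ e → mem C e ≡ true → mem T (tl e) ≡ false → mem T (hd e) ≡ true → mem F e ≡ true) →
    ϱ⁻ C T ≤ ϱ⁻ F T
  ϱ⁻-dominated C F T inside-F = sum-mono pointwise
    where
    pointwise : ∀ e → ⟦ mem C e ⟧ * ⟦ not (mem T (tl e)) ∧ mem T (hd e) ⟧ ≤ ⟦ mem F e ⟧ * ⟦ not (mem T (tl e)) ∧ mem T (hd e) ⟧
    pointwise e with mem C e in e∈C | mem T (tl e) in tl∈T | mem T (hd e) in hd∈T
    ... | false | _ | _ = z≤n
    ... | true | true | _ = ≤-reflexive (sym (*-zeroʳ ⟦ mem F e ⟧))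
    ... | true | false | false = ≤-reflexive (sym (*-zeroʳ ⟦ mem F e ⟧))
    ... | true | false | true rewrite inside-F e e∈C tl∈T hd∈T = ≤-refl

  -- Start from {v} and, while some C-edge e ∉ F
  -- enters T, replace T by T ∪ Y for a tight Y ∋ tl e blocking e (still tight by uncrossing).
  tight-closure : ∀ F → CutCondition F → (C : Subset m) →
    (∀ e → mem C e ≡ true → mem F e ≡ false → Blocked F e) →
    ∀ v → v ≢ r → Σ (Subset n) λ T → Tight F v T × ϱ⁻ C T ≤ ϱ⁻ F T
  tight-closure F cc C blocked v v≢r = grow (suc (missing ⁅ v ⁆)) ⁅ v ⁆ ≤-refl start
    where
    start : Tight F v ⁅ v ⁆
    start = singleton-around v v≢r , ≤-reflexive (ϱ⁻-singleton F v)
    bad : Subset n → Fin m → Bool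
    bad T e = mem C e ∧ not (mem T (tl e)) ∧ mem T (hd e) ∧ not (mem F e)
    grow : ∀ fuel T → missing T < fuel → Tight F v T → Σ (Subset n) λ T → Tight F v T × ϱ⁻ C T ≤ ϱ⁻ F T
    grow (suc fuel) T lt tight with any? (λ e → bad T e ≟ᵇ true)
    ... | no none = T , tight , ϱ⁻-dominated C F T inside-F
      where
      inside-F : ∀ e → mem C e ≡ true → mem T (tl e) ≡ false → mem T (hd e) ≡ true → mem F e ≡ true
      inside-F e e∈C tl∉T hd∈T with mem F e in e∈F
      ... | true = refl
      ... | false = ⊥-elim (none (e , trans (cong₂ (λ a b → a ∧ not b ∧ mem T (hd e) ∧ not (mem F e)) e∈C tl∉T)
                                             (cong₂ (λ a b → a ∧ not b) hd∈T e∈F)))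
    ... | yes (e , e-bad) = enlarge (blocked e e∈C e∉F)
      where
      e∈C : mem C e ≡ true
      e∈C = proj₁ (∧-true e-bad)
      enters-T : (not (mem T (tl e)) ∧ mem T (hd e) ∧ not (mem F e)) ≡ true
      enters-T = proj₂ (∧-true {mem C e} e-bad)
      tl∉T : mem T (tl e) ≡ false
      tl∉T = not-true (proj₁ (∧-true enters-T))
      hd∈T : mem T (hd e) ≡ true
      hd∈T = proj₁ (∧-true (proj₂ (∧-true {not (mem T (tl e))} enters-T)))
      e∉F : mem F e ≡ false
      e∉F = not-true (proj₂ (∧-true {mem T (hd e)} (proj₂ (∧-true {not (mem T (tl e))} enters-T))))
      enlarge : Blocked F e → Σ (Subset n) λ T → Tight F v T × ϱ⁻ C T ≤ ϱ⁻ F T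
      enlarge (Y , Y-tight , tl∈Y) =
        grow fuel (T ∪ Y) (≤-trans (missing-∪ T Y (tl e) tl∉T tl∈Y) (≤-pred lt))
             (tight-∪ F cc {v} {hd e} {T} {Y} tight Y-tight hd∈T)

  empty-flame : IsFlame D r ∅
  empty-flame = cut-condition⇒flame ∅ (λ v _ _ _ → ≤-trans (≤-reflexive (ϱ-∅ v)) z≤n)
    where
    ϱ-∅ : ∀ v → ϱ ∅ v ≡ 0
    ϱ-∅ v = sum-zero _ (λ e → cong (λ b → ⟦ b ⟧ * ⟦ hd e ≡ᵇ v ⟧) (lookup-replicate e false))

  -- Whether e can be added from F' to the flame F is decidable: adding it either gives a flame or is blocked.
  addable? : ∀ F → IsFlame D r F → ∀ F' e → Dec ((mem F' e ∧ not (mem F e)) ≡ true × IsFlame D r (F ∪ ⁅ e ⁆))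
  addable? F flame F' e with mem F' e | mem F e in e∈F
  ... | false | _ = no (λ ())
  ... | true | true = no (λ ())
  ... | true | false with AddEdge.extend F e e∈F (flame⇒cut-condition F flame)
  ...   | inj₁ flame' = yes (refl , flame')
  ...   | inj₂ blocked = no (AddEdge.blocked⇒not-flame F e e∈F blocked ∘ proj₂)

  -- Otherwise all edges of F' ∖ F are blocked, and at a vertex v with ϱ_F(v) < ϱ_F'(v)
  -- the tight closure T gives ϱ_F'(v) ≤ ϱ_F'(T) ≤ ϱ_F(T) ≤ ϱ_F(v).
  flame-exchange : ∀ F F' → IsFlame D r F → IsFlame D r F' → ∣ F ∣ < ∣ F' ∣ →
    ∃ λ e → e ∈ F' × e ∉ F × IsFlame D r (F ∪ ⁅ e ⁆)
  flame-exchange F F' flame flame' |F|<|F'| with any? (addable? F flame F')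
  ... | yes (e , new , flame'') = e , mem⇒∈ (proj₁ (∧-true new)) , e∉F , flame''
    where
    e∉F : e ∉ F
    e∉F e∈F = true≢false (trans (sym (∈⇒mem e∈F)) (not-true (proj₂ (∧-true {mem F' e} new))))
  ... | no none with any? (λ v → ϱ F v <? ϱ F' v)
  ...   | no nowhere = ⊥-elim (<⇒≱ |F|<|F'| (begin
          ∣ F' ∣                  ≡⟨ sum-inn F' ⟨
          sum (λ v → ϱ F' v)      ≤⟨ sum-mono (λ v → ≮⇒≥ (λ lt → nowhere (v , lt))) ⟩
          sum (λ v → ϱ F v)       ≡⟨ sum-inn F ⟩
          ∣ F ∣                   ∎))
    where open ≤-Reasoning
  ...   | yes (v , more) = ⊥-elim (<⇒≱ more (bound (tight-closure F (flame⇒cut-condition F flame) F' blocked v v≢r)))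
    where
    v≢r : v ≢ r
    v≢r refl = n≮0 (subst (ϱ F r <_) (ϱ-at-r F') more)
    blocked : ∀ e → mem F' e ≡ true → mem F e ≡ false → Blocked F e
    blocked e e∈F' e∉F with AddEdge.extend F e e∉F (flame⇒cut-condition F flame)
    ... | inj₂ b = b
    ... | inj₁ flame'' = ⊥-elim (none (e , cong₂ (λ a b → a ∧ not b) e∈F' e∉F , flame''))
    bound : (Σ (Subset n) λ T → Tight F v T × ϱ⁻ F' T ≤ ϱ⁻ F T) → ϱ F' v ≤ ϱ F v
    bound (T , (around , tight) , dominated) = begin
      ϱ F' v                  ≤⟨ flame⇒cut-condition F' flame' v v≢r T around ⟩
      ϱ⁻ F' T                 ≤⟨ dominated ⟩
      ϱ⁻ F T                  ≤⟨ tight ⟩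
      ϱ F v                   ∎
      where open ≤-Reasoning

  -- Every edge outside F* is blocked, so the tight closure for C = E(D) gives a set T with
  -- λ_D(r,v) ≤ ϱ_D(T) ≤ ϱ_F*(T) ≤ ϱ_F*(v) ≤ λ_F*(r,v), and λ_F* ≤ λ_D by monotonicity.
  maximal-flame-λ : ∀ F* → IsFlame D r F* → (∀ F → IsFlame D r F → F* ⊆ F → F ⊆ F*) →
    ∀ v → v ≢ r → ∀ k → IsLambda D F* r v k ⇔ IsLambda D ⊤ r v k
  maximal-flame-λ F* flame maximal v v≢r k
    with lambda-menger F* r v (v≢r ∘ sym) | lambda-menger ⊤ r v (v≢r ∘ sym)
  ... | k* , paths* , (Y* , r∉Y* , v∈Y* , size*) , λ*
      | k⊤ , paths⊤ , (Y⊤ , r∉Y⊤ , v∈Y⊤ , size⊤) , λ⊤ =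
    mk⇔ (λ λ*-k → Equivalence.from (λ⊤ k) (trans (Equivalence.to (λ* k) λ*-k) k*≡k⊤))
        (λ λ⊤-k → Equivalence.from (λ* k) (trans (Equivalence.to (λ⊤ k) λ⊤-k) (sym k*≡k⊤)))
    where
    cc : CutCondition F*
    cc = flame⇒cut-condition F* flame
    blocked : ∀ e → mem ⊤ e ≡ true → mem F* e ≡ false → Blocked F* e
    blocked e _ e∉F* with AddEdge.extend F* e e∉F* cc
    ... | inj₂ b = b
    ... | inj₁ flame' = ⊥-elim (true≢false (trans (sym (∈⇒mem (maximal _ flame' (p⊆p∪q ⁅ e ⁆) (q⊆p∪q F* ⁅ e ⁆ (x∈⁅x⁆ e))))) e∉F*))
    bound : (Σ (Subset n) λ T → Tight F* v T × ϱ⁻ ⊤ T ≤ ϱ⁻ F* T) → k⊤ ≤ k*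
    bound (T , ((r∉T , v∈T) , tight) , dominated) = begin
      k⊤             ≤⟨ paths≤cut T paths⊤ r∉T v∈T ⟩
      ϱ⁻ ⊤ T         ≤⟨ dominated ⟩
      ϱ⁻ F* T        ≤⟨ tight ⟩
      ϱ F* v         ≤⟨ cc v v≢r Y* (r∉Y* , v∈Y*) ⟩
      ϱ⁻ F* Y*       ≡⟨ size* ⟩
      k*             ∎
      where open ≤-Reasoning
    k*≡k⊤ : k* ≡ k⊤
    k*≡k⊤ = ≤-antisym
      (≤-trans (paths≤cut Y⊤ (Menger.paths-mono D (λ _ → ∈⊤) paths*) r∉Y⊤ v∈Y⊤) (≤-reflexive size⊤))
      (bound (tight-closure F* cc ⊤ blocked v v≢r))

theorem2 : (D : Digraph) → (r : Fin (Digraph.n D)) →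
    (∀ e → Digraph.tl D e ≢ Digraph.hd D e) →
    (∀ e → Digraph.hd D e ≢ r) →
    IsGreedoid (IsFlame D r) ×
    (∀ (Fs : Subset (Digraph.m D)) → IsFlame D r Fs →
    (∀ F → IsFlame D r F → Fs ⊆ F → F ⊆ Fs) →
    ∀ v → v ≢ r → ∀ k →
    (IsLambda D Fs r v k → IsLambda D ⊤ r v k) ×
    (IsLambda D ⊤ r v k → IsLambda D Fs r v k))
theorem2 D r no-loop no-edge-into-r =
  (empty-flame , flame-exchange) ,
  λ F* flame maximal v v≢r k →
    let same-λ = maximal-flame-λ F* flame maximal v v≢r k
    in Equivalence.to same-λ , Equivalence.from same-λ
  where open Flames D r no-loop no-edge-into-r
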